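{- Suppose the Coffman–Sethi conjecture is false. Then in the LD schedule (witnessing the Type I2 property) of any minimal counterexample of Type I2, letting $i'$ be the unique machine whose completion time after rank $k$ equals the makespan, there exists a machine $i''\neq i'$ whose completion time after rank $k-1$ is greater than or equal to the completion time after rank $k-1$ of machine $i'$.
   Context: Problem FM: there are $m\ge 1$ identical parallel machines and $n=mk$ jobs ($k\ge 1$ is the number of ranks; an instance with fewer jobs is padded with jobs of processing time $0$), with nonnegative real processing times indexed so that $p_1\ge p_2\ge\cdots\ge p_n$. For $r\in\{1,\dots,k\}$, rank $r$ is the set of jobs $(r-1)m+1,\dots,rm$; $\lambda_r$ and $\mu_r$ denote the largest and smallest processing times in rank $r$. A flowtime-optimal schedule assigns to every machine exactly one job from each rank and processes the jobs on each machine consecutively from time $0$ without idle time, in the order rank $k$, \dots, rank $1$; its makespan is the largest machine completion time. $t^*$ denotes the minimum makespan over all flowtime-optimal schedules. LD algorithm: ranks are handled in the order $1,2,\dots,k$; when handling a rank, the largest job of that rank is assigned to a machine of smallest current load, the second largest to a machine of second smallest load, \dots, the smallest to a machine of largest load (ties broken arbitrarily); at the end the order of jobs on each machine is reversed. Any schedule obtainable this way is an LD schedule; the completion time of a machine after rank $r$ is the total processing time of its jobs of ranks $1,\dots,r$. The Coffman–Sethi conjecture asserts that for every $m$, every instance on $m$ machines and every LD schedule, the makespan of the LD schedule is at most $\frac{5m-2}{4m-1}t^*$; a counterexample is an instance having an LD schedule violating this. The approximation ratio of an instance is $t_{LD}/t^*$, where $t_{LD}$ is the largest makespan over its LD schedules.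 An instance is of Type I if all processing times are integers. A counterexample of Type I2 is a counterexample of Type I having an LD schedule in which exactly one machine $i'$ has completion time after rank $k$ equal to the makespan, and machine $i'$ has a job of processing time $\lambda_r$ in rank $r$ for every $r\in\{2,3,\dots,k\}$. A counterexample $P_2$ is smaller than a counterexample $P_1$ with $k$ ranks and $m$ machines if (i) $P_2$ has fewer than $k$ ranks, or (ii) $k$ ranks and fewer than $m$ machines, or (iii) $k$ ranks, $m$ machines and fewer jobs with nonzero processing time, or (iv) $k$ ranks, $m$ machines, the same number of nonzero jobs and a strictly larger approximation ratio, or (v) $k$ ranks, $m$ machines, the same number of nonzero jobs, the same ratio and a strictly smaller sum of processing times. A minimal counterexample of Type I2 is a counterexample of Type I2 such that no counterexample of Type I2 is smaller. -}

module Defs where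

open import Data.Nat using (ℕ; zero; suc; _+_; _*_; _∸_; _⊔_; _≤_; _<_; _<ᵇ_; _≡ᵇ_)
open import Data.Bool using (if_then_else_)
open import Data.Fin using (Fin; toℕ) renaming (zero to fzero; suc to fsuc; _<_ to _<ᶠ_)
open import Data.Fin.Permutation using (Permutation′; _⟨$⟩ʳ_; _⟨$⟩ˡ_)
open import Data.Product using (Σ; ∃; _×_; _,_)
open import Data.Sum using (_⊎_)
open import Relation.Binary.PropositionalEquality using (_≡_; _≢_)
open import Relation.Nullary using (¬_)

sumFin : (n : ℕ) → (Fin n → ℕ) → ℕ
sumFin zero    f = 0
sumFin (suc n) f = f fzero + sumFin n (λ i → f (fsuc i))

maxFin : (n : ℕ) → (Fin n → ℕ) → ℕ
maxFin zero    f = 0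
maxFin (suc n) f = f fzero ⊔ maxFin n (λ i → f (fsuc i))

-- An instance of problem FM with integer processing times (Type I).
-- Ranks are indexed by Fin k: rank index r (0-based) is rank r+1 of the paper.
-- Job j (0-based) of rank r is the job number r*m + j + 1 of the paper,
-- with processing time  time r j.
record Instance : Set where
  field
    m      : ℕ
    k      : ℕ
    m≥1    : 1 ≤ m
    k≥1    : 1 ≤ k
    time   : Fin k → Fin m → ℕ
    sorted : ∀ r j r' j' → toℕ r * m + toℕ j ≤ toℕ r' * m + toℕ j'
             → time r' j' ≤ time r j
open Instance public

-- A flowtime-optimal schedule: for each rank a bijection between jobs of the
-- rank and machines; (σ r ⟨$⟩ʳ j) is the machine receiving job j of rank r,
-- (σ r ⟨$⟩ˡ i) is the job of rank r on machine i.
Schedule : Instance → Set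
Schedule P = Fin (k P) → Permutation′ (m P)

jobOn : (P : Instance) → Schedule P → Fin (k P) → Fin (m P) → ℕ
jobOn P σ r i = time P r (σ r ⟨$⟩ˡ i)

-- completion time of machine i after rank n (paper's 1-based n):
-- total processing time of its jobs of ranks 1..n.
completion : (P : Instance) → Schedule P → ℕ → Fin (m P) → ℕ
completion P σ n i = sumFin (k P) (λ r → if toℕ r <ᵇ n then jobOn P σ r i else 0)

makespan : (P : Instance) → Schedule P → ℕ
makespan P σ = maxFin (m P) (completion P σ (k P))

IsTStar : (P : Instance) → ℕ → Set
IsTStar P t = (Σ (Schedule P) λ σ → makespan P σ ≡ t) × (∀ σ → t ≤ makespan P σ)

-- LD schedule: when handling rank r (0-based, so loads are completion times
-- after paper-rank r), job j (the (j+1)-th largest) goes to a machine whose load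
-- is the (j+1)-th smallest: loads of receiving machines are nondecreasing in j
-- (ties broken arbitrarily).
IsLD : (P : Instance) → Schedule P → Set
IsLD P σ = ∀ (r : Fin (k P)) (j j' : Fin (m P)) → j <ᶠ j'
  → completion P σ (toℕ r) (σ r ⟨$⟩ʳ j) ≤ completion P σ (toℕ r) (σ r ⟨$⟩ʳ j')

IsTLD : (P : Instance) → ℕ → Set
IsTLD P t = (Σ (Schedule P) λ σ → IsLD P σ × makespan P σ ≡ t)
          × (∀ σ → IsLD P σ → makespan P σ ≤ t)

-- the LD schedule σ violates the Coffman–Sethi bound:
-- makespan σ > (5m-2)/(4m-1) t*   (cross-multiplied, 4m-1 > 0)
Violates : (P : Instance) → Schedule P → Set
Violates P σ = Σ ℕ λ t → IsTStar P t
  × ((5 * m P ∸ 2) * t < (4 * m P ∸ 1) * makespan P σ)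

Counterexample : Instance → Set
Counterexample P = Σ (Schedule P) λ σ → IsLD P σ × Violates P σ

lam : (P : Instance) → Fin (k P) → ℕ
lam P r = maxFin (m P) (time P r)

I2Witness : (P : Instance) → Schedule P → Fin (m P) → Set
I2Witness P σ i' = IsLD P σ × Violates P σ
  × completion P σ (k P) i' ≡ makespan P σ
  × (∀ i → i ≢ i' → completion P σ (k P) i ≢ makespan P σ)
  × (∀ (r : Fin (k P)) → 1 ≤ toℕ r → jobOn P σ r i' ≡ lam P r)

TypeI2 : Instance → Set
TypeI2 P = Σ (Schedule P) λ σ → Σ (Fin (m P)) λ i' → I2Witness P σ i'

nonzeroJobs : Instance → ℕ
nonzeroJobs P = sumFin (k P) λ r → sumFin (m P) λ j → if time P r j ≡ᵇ 0 then 0 else 1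

totalTime : Instance → ℕ
totalTime P = sumFin (k P) λ r → sumFin (m P) (time P r)

-- P₂ (with t_LD = a₂, t* = b₂) is smaller than P₁ (with t_LD = a₁, t* = b₁).
-- Ratios a/b compared by cross-multiplication (t* > 0 for counterexamples).
Smaller : (P₂ : Instance) (a₂ b₂ : ℕ) (P₁ : Instance) (a₁ b₁ : ℕ) → Set
Smaller P₂ a₂ b₂ P₁ a₁ b₁ =
    k P₂ < k P₁
  ⊎ (k P₂ ≡ k P₁ × m P₂ < m P₁)
  ⊎ (k P₂ ≡ k P₁ × m P₂ ≡ m P₁ × nonzeroJobs P₂ < nonzeroJobs P₁)
  ⊎ (k P₂ ≡ k P₁ × m P₂ ≡ m P₁ × nonzeroJobs P₂ ≡ nonzeroJobs P₁
       × a₁ * b₂ < a₂ * b₁)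
  ⊎ (k P₂ ≡ k P₁ × m P₂ ≡ m P₁ × nonzeroJobs P₂ ≡ nonzeroJobs P₁
       × a₁ * b₂ ≡ a₂ * b₁ × totalTime P₂ < totalTime P₁)

MinimalTypeI2 : Instance → Set
MinimalTypeI2 P = TypeI2 P ×
  (∀ P₂ a₂ b₂ a₁ b₁ → IsTLD P₂ a₂ → IsTStar P₂ b₂ → IsTLD P a₁ → IsTStar P b₁
     → TypeI2 P₂ → ¬ Smaller P₂ a₂ b₂ P a₁ b₁)

module Submission where

open import Defs
open import Data.Nat using (ℕ; _≤_; _∸_)
open import Data.Fin using (Fin)
open import Data.Product using (Σ; _×_)
open import Relation.Binary.PropositionalEquality using (_≢_)

open import Data.Nat using (zero; suc; _+_; _*_; _<_; _<ᵇ_; _⊔_; _≤?_; z≤n; s≤s; s≤s⁻¹)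
open import Data.Nat.Properties
open import Data.Bool using (true; false; if_then_else_; T)
open import Data.Fin using (toℕ; inject₁; fromℕ) renaming (zero to fzero; suc to fsuc; _<_ to _<ᶠ_)
import Data.Fin.Properties as Fin
open import Data.Fin.Permutation using (_⟨$⟩ʳ_; _⟨$⟩ˡ_; inverseʳ; inverseˡ)
open import Data.Product using (_,_; proj₁; proj₂)
open import Data.Sum using (inj₁; inj₂)
open import Data.Empty using (⊥; ⊥-elim)
open import Relation.Nullary using (¬_; yes; no)
open import Relation.Nullary.Decidable using (¬?; _×-dec_; ¬¬-excluded-middle)
open import Relation.Nullary.Negation using (DoubleNegation; contradiction)
open import Relation.Binary.PropositionalEquality using (_≡_; refl; sym; trans; cong; cong₂; subst; subst₂; module ≡-Reasoning)

-- Suppose no machine i'' ≠ i' reaches the load of i' after rank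
-- k-1, i.e. i' is a strict leader after rank k-1.
--  * If k = 1, every load after rank 0 is 0, so i' must be the only machine;
--    with one machine all schedules have the same makespan and nothing can
--    violate the Coffman–Sethi bound.
--  * If k ≥ 2, drop the last rank.  Being the strict leader, i' received the
--    smallest job c of rank k (LD rule), so t_LD loses exactly c while t* loses
--    at least c; since the bound (5m-2)/(4m-1) is ≥ 1 the truncated LD schedule
--    still violates it, and it is still of Type I2 with the same machine i'.
--    The truncated instance has fewer ranks, contradicting minimality.
-- Since the argument ends in a contradiction, t_LD and t* (extrema over all
-- schedules) are only needed under double negation.

sumFin-cong : ∀ n (f g : Fin n → ℕ) → (∀ i → f i ≡ g i) → sumFin n f ≡ sumFin n g
sumFin-cong zero    f g f≡g = refl
sumFin-cong (suc n) f g f≡g =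
  cong₂ _+_ (f≡g fzero) (sumFin-cong n _ _ (λ i → f≡g (fsuc i)))

sumFin-mono : ∀ n (f g : Fin n → ℕ) → (∀ i → f i ≤ g i) → sumFin n f ≤ sumFin n g
sumFin-mono zero    f g f≤g = z≤n
sumFin-mono (suc n) f g f≤g =
  +-mono-≤ (f≤g fzero) (sumFin-mono n _ _ (λ i → f≤g (fsuc i)))

sumFin-snoc : ∀ n (f : Fin (suc n) → ℕ)
            → sumFin (suc n) f ≡ sumFin n (λ i → f (inject₁ i)) + f (fromℕ n)
sumFin-snoc zero    f = +-comm (f fzero) 0
sumFin-snoc (suc n) f =
  trans (cong (f fzero +_) (sumFin-snoc n (λ i → f (fsuc i))))
        (sym (+-assoc (f fzero) _ _))

maxFin-cong : ∀ n (f g : Fin n → ℕ) → (∀ i → f i ≡ g i) → maxFin n f ≡ maxFin n g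
maxFin-cong zero    f g f≡g = refl
maxFin-cong (suc n) f g f≡g =
  cong₂ _⊔_ (f≡g fzero) (maxFin-cong n _ _ (λ i → f≡g (fsuc i)))

maxFin-upper : ∀ n (f : Fin n → ℕ) i → f i ≤ maxFin n f
maxFin-upper (suc n) f fzero    = m≤m⊔n _ _
maxFin-upper (suc n) f (fsuc i) =
  ≤-trans (maxFin-upper n (λ j → f (fsuc j)) i) (m≤n⊔m (f fzero) _)

maxFin-least : ∀ n (f : Fin n → ℕ) x → (∀ i → f i ≤ x) → maxFin n f ≤ x
maxFin-least zero    f x f≤x = z≤n
maxFin-least (suc n) f x f≤x = ⊔-lub (f≤x fzero) (maxFin-least n _ x (λ i → f≤x (fsuc i)))

maxFin-attained : ∀ {n} → 1 ≤ n → (f : Fin n → ℕ) → Σ (Fin n) λ i → maxFin n f ≤ f i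
maxFin-attained {suc zero} _ f = fzero , ⊔-lub ≤-refl z≤n
maxFin-attained {suc (suc n)} _ f with maxFin-attained (s≤s z≤n) (λ j → f (fsuc j))
... | i , max≤fi with ≤-total (f fzero) (f (fsuc i))
...   | inj₁ f0≤fi = fsuc i , ⊔-lub f0≤fi max≤fi
...   | inj₂ fi≤f0 = fzero  , ⊔-lub ≤-refl (≤-trans max≤fi fi≤f0)

if-true : ∀ {b} (x : ℕ) → T b → (if b then x else 0) ≡ x
if-true {true} x _ = refl

if-false : ∀ {b} (x : ℕ) → ¬ T b → (if b then x else 0) ≡ 0
if-false {true}  x ¬b = ⊥-elim (¬b _)
if-false {false} x ¬b = refl

if-≤ : ∀ b (x y : ℕ) → x ≤ y → (if b then x else 0) ≤ y
if-≤ true  x y x≤y = x≤y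
if-≤ false x y x≤y = z≤n

¬¬-greatest : (S : ℕ → Set) (B : ℕ) → (∀ x → S x → x ≤ B) → ∀ x₀ → S x₀
            → DoubleNegation (Σ ℕ λ n → S n × (∀ x → S x → x ≤ n))
¬¬-greatest S zero    bounded x₀ Sx₀ no-max = no-max (x₀ , Sx₀ , λ x Sx → ≤-trans (bounded x Sx) z≤n)
¬¬-greatest S (suc B) bounded x₀ Sx₀ no-max = ¬¬-excluded-middle {A = S (suc B)} λ
  { (yes SB) → no-max (suc B , SB , bounded)
  ; (no ¬SB) → ¬¬-greatest S B (λ x Sx → below x Sx ¬SB) x₀ Sx₀ no-max }
  where
  below : ∀ x → S x → ¬ S (suc B) → x ≤ B
  below x Sx ¬SB with m≤n⇒m<n∨m≡n (bounded x Sx)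
  ... | inj₁ x<1+B = s≤s⁻¹ x<1+B
  ... | inj₂ refl  = ⊥-elim (¬SB Sx)

-- A satisfiable predicate has a least witness; B bounds the search.
¬¬-least : (S : ℕ → Set) (B : ℕ) → ∀ x₀ → x₀ ≤ B → S x₀
         → DoubleNegation (Σ ℕ λ n → S n × (∀ x → S x → n ≤ x))
¬¬-least S zero    x₀ x₀≤B Sx₀ no-min = no-min (x₀ , Sx₀ , λ x _ → ≤-trans x₀≤B z≤n)
¬¬-least S (suc B) x₀ x₀≤B Sx₀ no-min = ¬¬-excluded-middle {A = Σ ℕ λ y → y < x₀ × S y} λ
  { (yes (y , y<x₀ , Sy)) → ¬¬-least S B y (s≤s⁻¹ (≤-trans y<x₀ x₀≤B)) Sy no-min
  ; (no none-below)       → no-min (x₀ , Sx₀ , λ x Sx → ≮⇒≥ (λ x<x₀ → none-below (x , x<x₀ , Sx))) }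

makespan≤sumLam : (P : Instance) (τ : Schedule P) → makespan P τ ≤ sumFin (k P) (lam P)
makespan≤sumLam P τ = maxFin-least (m P) _ _ λ i → sumFin-mono (k P) _ _ λ r →
  if-≤ (toℕ r <ᵇ k P) _ _ (maxFin-upper (m P) (time P r) (τ r ⟨$⟩ˡ i))

¬¬-tLD : (P : Instance) (τ : Schedule P) → IsLD P τ → DoubleNegation (Σ ℕ λ a → IsTLD P a)
¬¬-tLD P τ τ-LD no-tLD =
  ¬¬-greatest (λ x → Σ (Schedule P) λ σ → IsLD P σ × makespan P σ ≡ x)
    (sumFin (k P) (lam P)) (λ { x (σ , _ , refl) → makespan≤sumLam P σ })
    (makespan P τ) (τ , τ-LD , refl)
    λ { (a , attained , greatest) → no-tLD (a , attained , λ σ σ-LD → greatest _ (σ , σ-LD , refl)) }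

¬¬-tStar : (P : Instance) (τ : Schedule P) → DoubleNegation (Σ ℕ λ b → IsTStar P b)
¬¬-tStar P τ no-tStar =
  ¬¬-least (λ x → Σ (Schedule P) λ σ → makespan P σ ≡ x)
    (makespan P τ) (makespan P τ) ≤-refl (τ , refl)
    λ { (b , attained , least) → no-tStar (b , attained , λ σ → least _ (σ , refl)) }

bound-numerator≥denominator : ∀ {m} → 1 ≤ m → 4 * m ∸ 1 ≤ 5 * m ∸ 2
bound-numerator≥denominator {m} m≥1 = ∸-monoˡ-≤ 2 (+-monoˡ-≤ (4 * m) m≥1)

ratio-drop-common : ∀ A B b c t x M → B ≤ A → b + c ≤ t → A * t < B * (x + c) → x ≤ M
                  → A * b < B * M
ratio-drop-common A B b c t x M B≤A b+c≤t At<B[x+c] x≤M =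
  +-cancelʳ-< (A * c) (A * b) (B * M) (begin-strict
    A * b + A * c   ≡⟨ sym (*-distribˡ-+ A b c) ⟩
    A * (b + c)     ≤⟨ *-monoʳ-≤ A b+c≤t ⟩
    A * t           <⟨ At<B[x+c] ⟩
    B * (x + c)     ≡⟨ *-distribˡ-+ B x c ⟩
    B * x + B * c   ≤⟨ +-mono-≤ (*-monoʳ-≤ B x≤M) (*-monoˡ-≤ c B≤A) ⟩
    B * M + A * c   ∎)
  where open ≤-Reasoning

no-violation-if-makespan-fixed : (P : Instance) (σ : Schedule P)
  → (∀ τ → makespan P τ ≡ makespan P σ) → ¬ Violates P σ
no-violation-if-makespan-fixed P σ fixed (t , ((σ₀ , σ₀-makespan) , _) , violation) =
  <⇒≱ violation (*-mono-≤ (bound-numerator≥denominator (m≥1 P)) (≤-reflexive (sym t≡makespan)))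
  where
  t≡makespan : t ≡ makespan P σ
  t≡makespan = trans (sym σ₀-makespan) (fixed σ₀)

single-machine-makespan : (P : Instance) → ((x y : Fin (m P)) → x ≡ y)
  → ∀ τ σ → makespan P τ ≡ makespan P σ
single-machine-makespan P unique τ σ = maxFin-cong (m P) _ _ λ i → sumFin-cong (k P) _ _ λ r →
  cong (λ j → if toℕ r <ᵇ k P then time P r j else 0) (unique (τ r ⟨$⟩ˡ i) (σ r ⟨$⟩ˡ i))

StrictLeader : (P : Instance) → Schedule P → ℕ → Fin (m P) → Set
StrictLeader P σ n i' = ∀ i → i ≢ i' → completion P σ n i < completion P σ n i'

strict-leader-is-max : (P : Instance) (σ : Schedule P) (n : ℕ) (i' : Fin (m P))
  → StrictLeader P σ n i' → maxFin (m P) (completion P σ n) ≡ completion P σ n i'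
strict-leader-is-max P σ n i' leads =
  ≤-antisym (maxFin-least (m P) _ _ below-leader) (maxFin-upper (m P) (completion P σ n) i')
  where
  below-leader : ∀ i → completion P σ n i ≤ completion P σ n i'
  below-leader i with i Fin.≟ i'
  ... | yes refl = ≤-refl
  ... | no  i≢i' = <⇒≤ (leads i i≢i')

strict-leader-at-start-is-alone : (P : Instance) (σ : Schedule P) (i' : Fin (m P))
  → StrictLeader P σ 0 i' → ∀ x y → x ≡ y
strict-leader-at-start-is-alone P σ i' leads x y = trans (is-i' x) (sym (is-i' y))
  where
  is-i' : ∀ i → i ≡ i'
  is-i' i with i Fin.≟ i'
  ... | yes i≡i' = i≡i'
  ... | no  i≢i' = contradiction (leads i i≢i')
                     (≤⇒≯ (≤-reflexive (sumFin-cong (k P) _ _ λ _ → refl)))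

-- LD rule: a strict leader after rank r receives a smallest job of rank r+1,
-- since every larger-indexed (smaller) job goes to a machine at least as loaded.
strict-leader-gets-smallest-job : (P : Instance) (σ : Schedule P) → IsLD P σ
  → (r : Fin (k P)) (i' : Fin (m P)) → StrictLeader P σ (toℕ r) i'
  → ∀ j → jobOn P σ r i' ≤ time P r j
strict-leader-gets-smallest-job P σ σ-LD r i' leads j with toℕ j ≤? toℕ (σ r ⟨$⟩ˡ i')
... | yes j≤j' = sorted P r j r (σ r ⟨$⟩ˡ i') (+-monoʳ-≤ (toℕ r * m P) j≤j')
... | no  j≰j' = contradiction LD-load-order (<⇒≱ (leads (σ r ⟨$⟩ʳ j) gets-j-not-i'))
  where
  j' = σ r ⟨$⟩ˡ i'
  j'<j : j' <ᶠ j
  j'<j = ≰⇒> j≰j'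
  gets-j-not-i' : σ r ⟨$⟩ʳ j ≢ i'
  gets-j-not-i' e = <-irrefl (cong toℕ (trans (sym (cong (σ r ⟨$⟩ˡ_) e)) (inverseˡ (σ r)))) j'<j
  LD-load-order : completion P σ (toℕ r) i' ≤ completion P σ (toℕ r) (σ r ⟨$⟩ʳ j)
  LD-load-order = subst (λ i → completion P σ (toℕ r) i ≤ completion P σ (toℕ r) (σ r ⟨$⟩ʳ j))
                        (inverseʳ (σ r)) (σ-LD r j' j j'<j)

module DropLastRank (m k : ℕ) (m≥1 : 1 ≤ m) (k+1≥1 : 1 ≤ suc k) (k≥1 : 1 ≤ k)
  (time : Fin (suc k) → Fin m → ℕ)
  (sorted : ∀ r j r' j' → toℕ r * m + toℕ j ≤ toℕ r' * m + toℕ j' → time r' j' ≤ time r j)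
  where

  P : Instance
  P = record { m = m ; k = suc k ; m≥1 = m≥1 ; k≥1 = k+1≥1 ; time = time ; sorted = sorted }

  P₂ : Instance
  P₂ = record { m = m ; k = k ; m≥1 = m≥1 ; k≥1 = k≥1
              ; time = λ r → time (inject₁ r) ; sorted = sorted₂ }
    where
    sorted₂ : ∀ r j r' j' → toℕ r * m + toℕ j ≤ toℕ r' * m + toℕ j'
            → time (inject₁ r') j' ≤ time (inject₁ r) j
    sorted₂ r j r' j' before = sorted (inject₁ r) j (inject₁ r') j'
      (subst₂ (λ a b → a * m + toℕ j ≤ b * m + toℕ j')
              (sym (Fin.toℕ-inject₁ r)) (sym (Fin.toℕ-inject₁ r')) before)

  lastRank : Fin (suc k)
  lastRank = fromℕ k

  restrict : Schedule P → Schedule P₂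
  restrict τ r = τ (inject₁ r)

  completion-restrict : (τ : Schedule P) (n : ℕ) (i : Fin m) → n ≤ k
    → completion P τ n i ≡ completion P₂ (restrict τ) n i
  completion-restrict τ n i n≤k = begin
    completion P τ n i
      ≡⟨ sumFin-snoc k (λ r → if toℕ r <ᵇ n then jobOn P τ r i else 0) ⟩
    sumFin k (λ r → if toℕ (inject₁ r) <ᵇ n then jobOn P τ (inject₁ r) i else 0)
      + (if toℕ lastRank <ᵇ n then jobOn P τ lastRank i else 0)
      ≡⟨ cong₂ _+_ (sumFin-cong k _ _ λ r → cong (λ x → if x <ᵇ n then jobOn P τ (inject₁ r) i else 0)
                                                  (Fin.toℕ-inject₁ r))
                   (if-false (jobOn P τ lastRank i) lastRank-excluded) ⟩
    completion P₂ (restrict τ) n i + 0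
      ≡⟨ +-identityʳ _ ⟩
    completion P₂ (restrict τ) n i ∎
    where
    open ≡-Reasoning
    lastRank-excluded : ¬ T (toℕ lastRank <ᵇ n)
    lastRank-excluded below = <⇒≱ (subst (_< n) (Fin.toℕ-fromℕ k) (<ᵇ⇒< _ _ below)) n≤k

  completion-full : (τ : Schedule P) (i : Fin m)
    → completion P τ (suc k) i ≡ completion P₂ (restrict τ) k i + jobOn P τ lastRank i
  completion-full τ i = trans (sumFin-snoc k (λ r → if toℕ r <ᵇ suc k then jobOn P τ r i else 0))
    (cong₂ _+_ (sumFin-cong k _ _ λ r →
                  trans (if-true (jobOn P τ (inject₁ r) i) (<⇒<ᵇ (Fin.toℕ<n (inject₁ r))))
                        (sym (if-true (jobOn P τ (inject₁ r) i) (<⇒<ᵇ (Fin.toℕ<n r)))))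
               (if-true (jobOn P τ lastRank i) (<⇒<ᵇ (Fin.toℕ<n lastRank))))

  restrict-LD : (τ : Schedule P) → IsLD P τ → IsLD P₂ (restrict τ)
  restrict-LD τ τ-LD r j j' j<j' = subst₂ _≤_ (same-load j) (same-load j') (τ-LD (inject₁ r) j j' j<j')
    where
    same-load : ∀ x → completion P τ (toℕ (inject₁ r)) (τ (inject₁ r) ⟨$⟩ʳ x)
                    ≡ completion P₂ (restrict τ) (toℕ r) (τ (inject₁ r) ⟨$⟩ʳ x)
    same-load x = trans (completion-restrict τ _ _ (s≤s⁻¹ (Fin.toℕ<n (inject₁ r))))
                        (cong (λ n → completion P₂ (restrict τ) n (τ (inject₁ r) ⟨$⟩ʳ x)) (Fin.toℕ-inject₁ r))

  -- If every job of the last rank is at least c, then t*(P₂) + c ≤ t*(P):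
  -- restricting an optimal schedule of P loses at least c on its busiest machine.
  tStar-gap : ∀ t b c → IsTStar P t → IsTStar P₂ b → (∀ j → c ≤ time lastRank j) → b + c ≤ t
  tStar-gap t b c ((σ₀ , σ₀-makespan) , _) (_ , b-least) c-smallest = begin
    b + c
      ≤⟨ +-mono-≤ (≤-trans (b-least (restrict σ₀)) busiest-attains) (c-smallest (σ₀ lastRank ⟨$⟩ˡ i₀)) ⟩
    completion P₂ (restrict σ₀) k i₀ + jobOn P σ₀ lastRank i₀
      ≡⟨ sym (completion-full σ₀ i₀) ⟩
    completion P σ₀ (suc k) i₀
      ≤⟨ maxFin-upper m (completion P σ₀ (suc k)) i₀ ⟩
    makespan P σ₀
      ≡⟨ σ₀-makespan ⟩
    t ∎
    where
    open ≤-Reasoning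
    busiest = maxFin-attained m≥1 (completion P₂ (restrict σ₀) k)
    i₀ = proj₁ busiest
    busiest-attains = proj₂ busiest

  restrict-I2Witness : (σ : Schedule P) (i' : Fin m) → I2Witness P σ i'
    → StrictLeader P σ k i' → ∀ b → IsTStar P₂ b → I2Witness P₂ (restrict σ) i'
  restrict-I2Witness σ i' (σ-LD , (t , t-star , violation) , i'-makespan , _ , i'-largest) leads b b-star =
    restrict-LD σ σ-LD , (b , b-star , violation₂) , sym makespan₂ , unique₂ , largest₂
    where
    σ₂ = restrict σ
    C₂ = completion P₂ σ₂ k
    c = jobOn P σ lastRank i'

    leads₂ : StrictLeader P₂ σ₂ k i'
    leads₂ i i≢i' = subst₂ _<_ (completion-restrict σ k i ≤-refl) (completion-restrict σ k i' ≤-refl)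
                           (leads i i≢i')

    makespan₂ : makespan P₂ σ₂ ≡ C₂ i'
    makespan₂ = strict-leader-is-max P₂ σ₂ k i' leads₂

    unique₂ : ∀ i → i ≢ i' → C₂ i ≢ makespan P₂ σ₂
    unique₂ i i≢i' e = <-irrefl (trans e makespan₂) (leads₂ i i≢i')

    largest₂ : ∀ (r : Fin k) → 1 ≤ toℕ r → jobOn P₂ σ₂ r i' ≡ lam P₂ r
    largest₂ r r≥1 = i'-largest (inject₁ r) (subst (1 ≤_) (sym (Fin.toℕ-inject₁ r)) r≥1)

    c-smallest : ∀ j → c ≤ time lastRank j
    c-smallest = strict-leader-gets-smallest-job P σ σ-LD lastRank i'
                   (subst (λ n → StrictLeader P σ n i') (sym (Fin.toℕ-fromℕ k)) leads)

    violation-split : (5 * m ∸ 2) * t < (4 * m ∸ 1) * (C₂ i' + c)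
    violation-split = subst (λ x → (5 * m ∸ 2) * t < (4 * m ∸ 1) * x)
                            (trans (sym i'-makespan) (completion-full σ i')) violation

    violation₂ : (5 * m ∸ 2) * b < (4 * m ∸ 1) * makespan P₂ σ₂
    violation₂ = ratio-drop-common (5 * m ∸ 2) (4 * m ∸ 1) b c t (C₂ i') (makespan P₂ σ₂)
                   (bound-numerator≥denominator m≥1) (tStar-gap t b c t-star b-star c-smallest)
                   violation-split (≤-reflexive (sym makespan₂))

  no-strict-leader : MinimalTypeI2 P → (σ : Schedule P) (i' : Fin m) → I2Witness P σ i'
    → ¬ StrictLeader P σ k i'
  no-strict-leader (_ , minimal) σ i' W@(σ-LD , (t , t-star , _) , _) leads =
    ¬¬-tLD P₂ (restrict σ) (restrict-LD σ σ-LD) λ { (a₂ , a₂-tLD) →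
    ¬¬-tStar P₂ (restrict σ) λ { (b₂ , b₂-tStar) →
    ¬¬-tLD P σ σ-LD λ { (a , a-tLD) →
    minimal P₂ a₂ b₂ a t a₂-tLD b₂-tStar a-tLD t-star
      (restrict σ , i' , restrict-I2Witness σ i' W leads b₂ b₂-tStar)
      (inj₁ ≤-refl) } } }

witness-not-strict-leader : (P : Instance) → MinimalTypeI2 P
  → (σ : Schedule P) (i' : Fin (m P)) → I2Witness P σ i'
  → ¬ StrictLeader P σ (k P ∸ 1) i'
witness-not-strict-leader P@record { k = suc zero } _ σ i' (_ , violation , _) leads =
  no-violation-if-makespan-fixed P σ
    (λ τ → single-machine-makespan P (strict-leader-at-start-is-alone P σ i' leads) τ σ) violation
witness-not-strict-leader record { m = m ; k = suc (suc k) ; m≥1 = m≥1 ; k≥1 = k+1≥1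
                                 ; time = time ; sorted = sorted } =
  DropLastRank.no-strict-leader m (suc k) m≥1 k+1≥1 (s≤s z≤n) time sorted

lemma7p12 : (Σ Instance λ Q → Counterexample Q)
    → (P : Instance) → MinimalTypeI2 P
    → (σ : Schedule P) (i' : Fin (m P)) → I2Witness P σ i'
    → Σ (Fin (m P)) λ i'' → i'' ≢ i'
        × completion P σ (k P ∸ 1) i' ≤ completion P σ (k P ∸ 1) i''
lemma7p12 _ P minimal σ i' W
  with Fin.any? (λ i → ¬? (i Fin.≟ i') ×-dec (completion P σ (k P ∸ 1) i' ≤? completion P σ (k P ∸ 1) i))
... | yes rival = rival
... | no  no-rival = ⊥-elim (witness-not-strict-leader P minimal σ i' W
                      (λ i i≢i' → ≰⇒> (λ i'≤i → no-rival (i , i≢i' , i'≤i))))
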